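{- For every $n\ge1$, $m(n)-(n-1)\le m_1(n)=m_2(n)\le m(n)$.
   Context: For $\pi\in S_n$, its permutation matrix is $M(\pi)=(e_{\pi(1)},\dots,e_{\pi(n)})$ (columns are standard basis vectors). A matrix $T\in\mathcal{M}_{m,p}(\{0,1\})$ is regarded as toric (row indices modulo $m$, column indices modulo $p$); an $n\times n$ matrix $M$ is a block of $T$ if there exist $i_0,j_0$ with $T_{i_0+i,\,j_0+j}=M_{i,j}$ for all $1\le i,j\le n$. $T$ is a superpermutation matrix if $M(\pi)$ is a block of $T$ for every $\pi\in S_n$. $m_1(n)$ (resp. $m_2(n)$) is the smallest $m$ such that some $T\in\mathcal{M}_{m,n}(\{0,1\})$ (resp. $T\in\mathcal{M}_{n,m}(\{0,1\})$) is a superpermutation matrix. Let $\sigma\in S_n$ be $\sigma(i)=i+1$ for $i<n$, $\sigma(n)=1$, with values taken modulo $n$ in $[n]=\{1,\dots,n\}$. For $\pi\in S_n$ let $\mathrm{inc}(\pi)=\{\sigma^k\circ\pi:0\le k\le n-1\}$. A word $u$ over $[n]$ is universal for the equivalence relation $\mathcal{R}_2$ (whose classes are the sets $\mathrm{inc}(\pi)$) if for every $\pi\in S_n$ some contiguous factor $u(i)\cdots u(i+n-1)$ of $u$ equals the one-line word $\pi'(1)\cdots\pi'(n)$ of some $\pi'\in\mathrm{inc}(\pi)$. $m(n)$ is the minimal length of such a word. -}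

module Defs where

open import Data.Nat using (ℕ; zero; suc; _+_; _≤_)
open import Data.Nat.DivMod using (_mod_)
open import Data.Fin using (Fin; toℕ; _≟_)
open import Data.Fin.Permutation using (Permutation′; _⟨$⟩ʳ_)
open import Data.Bool using (Bool)
open import Data.List using (List; length; take; drop; tabulate)
open import Data.Product using (Σ; _×_; ∃; ∃-syntax)
open import Relation.Nullary using (does)
open import Relation.Binary.PropositionalEquality using (_≡_)

cyc : ∀ {m} → Fin m → ℕ → Fin m
cyc {suc m} i k = (toℕ i + k) mod (suc m)

Matrix : ℕ → ℕ → Set
Matrix m p = Fin m → Fin p → Bool

-- permutation matrix M(π) = (e_{π(1)},…,e_{π(n)}): entry (i,j) is 1 iff i = π(j)
permMatrix : ∀ {n} → Permutation′ n → Matrix n n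
permMatrix π i j = does (i ≟ (π ⟨$⟩ʳ j))

-- M is a block of the toric matrix T (0-based offsets i₀, j₀)
IsBlock : ∀ {n m p} → Matrix m p → Matrix n n → Set
IsBlock {n} {m} {p} T M =
  ∃[ i₀ ] ∃[ j₀ ] (∀ (i j : Fin n) → T (cyc i₀ (toℕ i)) (cyc j₀ (toℕ j)) ≡ M i j)

IsSuperpermutationMatrix : ∀ n {m p} → Matrix m p → Set
IsSuperpermutationMatrix n T = ∀ (π : Permutation′ n) → IsBlock T (permMatrix π)

SuperRows : ℕ → ℕ → Set
SuperRows n m = Σ (Matrix m n) (IsSuperpermutationMatrix n)

SuperCols : ℕ → ℕ → Set
SuperCols n m = Σ (Matrix n m) (IsSuperpermutationMatrix n)

-- σ(x) = x + 1 mod n (0-based version of σ(i)=i+1, σ(n)=1), and its powers σ^k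
σ : ∀ {n} → Fin n → Fin n
σ x = cyc x 1

σ^ : ∀ {n} → ℕ → Fin n → Fin n
σ^ zero x = x
σ^ (suc k) x = σ (σ^ k x)

oneLine : ∀ {n} → (Fin n → Fin n) → List (Fin n)
oneLine f = tabulate f

HasFactor : ∀ {n} → List (Fin n) → List (Fin n) → Set
HasFactor {n} u w = ∃[ i ] (take n (drop i u) ≡ w)

IsUniversalR₂ : ∀ n → List (Fin n) → Set
IsUniversalR₂ n u =
  ∀ (π : Permutation′ n) → ∃[ k ] (HasFactor u (oneLine (λ j → σ^ (toℕ {n} k) (π ⟨$⟩ʳ j))))

UniversalLength : ℕ → ℕ → Set
UniversalLength n L = Σ (List (Fin n)) (λ u → length u ≡ L × IsUniversalR₂ n u)

IsLeast : (ℕ → Set) → ℕ → Set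
IsLeast P k = P k × (∀ j → P j → k ≤ j)

-- A universal word u gives the |u| × n matrix whose row r has its single 1 in column u(r):
-- a factor σ^k ∘ π⁻¹ of u at position i is the block M(π) at offset (i, k), since shifting
-- the columns by k applies σ^k.  Conversely, reading off the column of the 1 in each row of
-- an m × n superpermutation matrix, cyclically continued for n - 1 more letters, gives a
-- universal word of length m + n - 1: the rows of a block M(π⁻¹) at column offset k spell
-- σ^k ∘ π.  Transposition turns the block M(π) into M(π⁻¹), so m₁ = m₂.
module Submission where

open import Defs
open import Data.Nat using (ℕ; _≤_; _∸_)
open import Data.Product using (_×_)
open import Relation.Binary.PropositionalEquality using (_≡_)

open import Data.Nat using (zero; suc; _+_; _*_; _%_; s≤s; s≤s⁻¹; z≤n)
open import Data.Nat.Properties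
  using (+-comm; +-assoc; +-suc; +-identityʳ; *-suc; ≤-antisym; ≤-trans; ≤-reflexive; +-monoˡ-≤; m≤n+o⇒m∸n≤o)
open import Data.Nat.DivMod using (_mod_; %-distribˡ-+; m%n%n≡m%n; [m+kn]%n≡m%n; m<n⇒m%n≡m; m%n<n)
open import Data.Fin using (Fin; toℕ; _≟_)
open import Data.Fin.Properties using (toℕ-injective; toℕ-fromℕ<; toℕ<n; any?)
open import Data.Fin.Permutation using (Permutation′; _⟨$⟩ʳ_; _⟨$⟩ˡ_; flip; id; inverseʳ)
open import Data.Bool using (true) renaming (_≟_ to _≟ᵇ_)
open import Data.List using (List; _∷_; length; lookup; take; drop; tabulate; applyUpTo)
open import Data.List.Properties
  using (∷-injectiveˡ; ∷-injectiveʳ; length-applyUpTo; tabulate-cong)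
open import Data.Product using (_,_; ∃-syntax; proj₁; proj₂)
open import Data.Empty using (⊥-elim)
open import Function using (_∘_; _⇔_; mk⇔; Inverse; Equivalence)
open import Relation.Nullary using (¬_; Dec; yes; no; does; proof)
open import Relation.Nullary.Reflects using (Reflects; invert)
open import Relation.Nullary.Decidable using (does-⇔; dec-true)
open import Relation.Binary.PropositionalEquality using (refl; sym; trans; cong; subst; module ≡-Reasoning)

open ≡-Reasoning

toℕ-cyc : ∀ {n} (x : Fin (suc n)) k → toℕ (cyc x k) ≡ (toℕ x + k) % suc n
toℕ-cyc {n} x k = toℕ-fromℕ< (m%n<n (toℕ x + k) (suc n))

cyc-without-wrap : ∀ {m} (x y : Fin m) k → toℕ x + k ≡ toℕ y → cyc x k ≡ y
cyc-without-wrap {suc m} x y k eq = toℕ-injective (begin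
  toℕ (cyc x k)        ≡⟨ toℕ-cyc x k ⟩
  (toℕ x + k) % suc m  ≡⟨ cong (_% suc m) eq ⟩
  toℕ y % suc m        ≡⟨ m<n⇒m%n≡m (toℕ<n y) ⟩
  toℕ y                ∎)

[m%n+k]%n≡[m+k]%n : ∀ m k n → (m % suc n + k) % suc n ≡ (m + k) % suc n
[m%n+k]%n≡[m+k]%n m k n = begin
  (m % suc n + k) % suc n                 ≡⟨ %-distribˡ-+ (m % suc n) k (suc n) ⟩
  (m % suc n % suc n + k % suc n) % suc n ≡⟨ cong (λ z → (z + k % suc n) % suc n) (m%n%n≡m%n m (suc n)) ⟩
  (m % suc n + k % suc n) % suc n         ≡⟨ sym (%-distribˡ-+ m k (suc n)) ⟩
  (m + k) % suc n                         ∎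

cyc-+ : ∀ {n} (x : Fin (suc n)) a b → cyc (cyc x a) b ≡ cyc x (a + b)
cyc-+ {n} x a b = toℕ-injective (begin
  toℕ (cyc (cyc x a) b)             ≡⟨ toℕ-cyc (cyc x a) b ⟩
  (toℕ (cyc x a) + b) % suc n       ≡⟨ cong (λ z → (z + b) % suc n) (toℕ-cyc x a) ⟩
  ((toℕ x + a) % suc n + b) % suc n ≡⟨ [m%n+k]%n≡[m+k]%n (toℕ x + a) b n ⟩
  (toℕ x + a + b) % suc n           ≡⟨ cong (_% suc n) (+-assoc (toℕ x) a b) ⟩
  (toℕ x + (a + b)) % suc n         ≡⟨ sym (toℕ-cyc x (a + b)) ⟩
  toℕ (cyc x (a + b))               ∎)

cyc-period : ∀ {n} (x : Fin (suc n)) a → cyc x (a + a * n) ≡ x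
cyc-period {n} x a = toℕ-injective (begin
  toℕ (cyc x (a + a * n))         ≡⟨ toℕ-cyc x (a + a * n) ⟩
  (toℕ x + (a + a * n)) % suc n   ≡⟨ cong (λ z → (toℕ x + z) % suc n) (sym (*-suc a n)) ⟩
  (toℕ x + a * suc n) % suc n     ≡⟨ [m+kn]%n≡m%n (toℕ x) a (suc n) ⟩
  toℕ x % suc n                   ≡⟨ m<n⇒m%n≡m (toℕ<n x) ⟩
  toℕ x                           ∎)

-- a * n ≡ - a modulo suc n.
cyc-cancelʳ : ∀ {n} (x : Fin (suc n)) a → cyc (cyc x a) (a * n) ≡ x
cyc-cancelʳ x a = trans (cyc-+ x a _) (cyc-period x a)

cyc-cancelˡ : ∀ {n} (x : Fin (suc n)) a → cyc (cyc x (a * n)) a ≡ x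
cyc-cancelˡ {n} x a = trans (cyc-+ x (a * n) a) (trans (cong (cyc x) (+-comm (a * n) a)) (cyc-period x a))

cyc-injective : ∀ {n} (x y : Fin (suc n)) a → cyc x a ≡ cyc y a → x ≡ y
cyc-injective {n} x y a eq = begin
  x                        ≡⟨ sym (cyc-cancelʳ x a) ⟩
  cyc (cyc x a) (a * n)    ≡⟨ cong (λ z → cyc z (a * n)) eq ⟩
  cyc (cyc y a) (a * n)    ≡⟨ cyc-cancelʳ y a ⟩
  y                        ∎

cyc-comm : ∀ {n} (x y : Fin (suc n)) → cyc x (toℕ y) ≡ cyc y (toℕ x)
cyc-comm {n} x y = toℕ-injective (begin
  toℕ (cyc x (toℕ y))         ≡⟨ toℕ-cyc x (toℕ y) ⟩
  (toℕ x + toℕ y) % suc n     ≡⟨ cong (_% suc n) (+-comm (toℕ x) (toℕ y)) ⟩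
  (toℕ y + toℕ x) % suc n     ≡⟨ sym (toℕ-cyc y (toℕ x)) ⟩
  toℕ (cyc y (toℕ x))         ∎)

cyc-surjective : ∀ {n} (x c : Fin (suc n)) → ∃[ b ] cyc x (toℕ b) ≡ c
cyc-surjective {n} x c = b , trans (cyc-comm x b) (cyc-cancelˡ c (toℕ x))
  where
  b : Fin (suc n)
  b = cyc c (toℕ x * n)

σ^-cyc : ∀ {n} k (x : Fin (suc n)) → σ^ k x ≡ cyc x k
σ^-cyc zero    x = sym (cyc-without-wrap x x 0 (+-identityʳ (toℕ x)))
σ^-cyc (suc k) x = begin
  cyc (σ^ k x) 1   ≡⟨ cong (λ z → cyc z 1) (σ^-cyc k x) ⟩
  cyc (cyc x k) 1  ≡⟨ cyc-+ x k 1 ⟩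
  cyc x (k + 1)    ≡⟨ cong (cyc x) (+-comm k 1) ⟩
  cyc x (suc k)    ∎

cyc-≡-σ^-⇔ : ∀ {n} (k b x : Fin (suc n)) → cyc k (toℕ b) ≡ σ^ (toℕ k) x ⇔ b ≡ x
cyc-≡-σ^-⇔ k b x = mk⇔
  (λ eq → cyc-injective b x (toℕ k) (trans (sym (cyc-comm k b)) (trans eq (σ^-cyc (toℕ k) x))))
  (λ { refl → trans (cyc-comm k b) (sym (σ^-cyc (toℕ k) b)) })

from-≡-⇔ : ∀ {n} (π : Permutation′ n) a b → b ≡ π ⟨$⟩ˡ a ⇔ a ≡ π ⟨$⟩ʳ b
from-≡-⇔ π a b = mk⇔ (sym ∘ Inverse.inverseˡ π) (sym ∘ Inverse.inverseʳ π)

_ᵀ : ∀ {m p} → Matrix m p → Matrix p m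
(T ᵀ) c r = T r c

permMatrix-flip : ∀ {n} (π : Permutation′ n) a b → permMatrix (flip π) b a ≡ permMatrix π a b
permMatrix-flip π a b = does-⇔ (from-≡-⇔ π a b) (b ≟ π ⟨$⟩ˡ a) (a ≟ π ⟨$⟩ʳ b)

ᵀ-superpermutation : ∀ n {m p} (T : Matrix m p) → IsSuperpermutationMatrix n T → IsSuperpermutationMatrix n (T ᵀ)
ᵀ-superpermutation n T S π with S (flip π)
... | i₀ , j₀ , block = j₀ , i₀ , λ a b → trans (block b a) (permMatrix-flip π a b)

superRows⇒superCols : ∀ n k → SuperRows n k → SuperCols n k
superRows⇒superCols n k (T , S) = T ᵀ , ᵀ-superpermutation n T S

superCols⇒superRows : ∀ n k → SuperCols n k → SuperRows n k
superCols⇒superRows n k (T , S) = T ᵀ , ᵀ-superpermutation n T S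

¬SuperRows-zero : ∀ n → ¬ SuperRows n 0
¬SuperRows-zero n (T , S) with S id
... | () , _

lookup-prefix : ∀ {A : Set} {n} (u : List A) (g : Fin n → A) → take n u ≡ tabulate g →
  ∀ a → ∃[ r ] toℕ r ≡ toℕ a × lookup u r ≡ g a
lookup-prefix {n = suc n} (x ∷ u) g eq Fin.zero = Fin.zero , refl , ∷-injectiveˡ eq
lookup-prefix {n = suc n} (x ∷ u) g eq (Fin.suc a) with lookup-prefix u (g ∘ Fin.suc) (∷-injectiveʳ eq) a
... | r , toℕ-r , lookup-r = Fin.suc r , cong suc toℕ-r , lookup-r

lookup-factor : ∀ {A : Set} {n} (u : List A) i (g : Fin n → A) → take n (drop i u) ≡ tabulate g →
  ∀ a → ∃[ r ] toℕ r ≡ i + toℕ a × lookup u r ≡ g a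
lookup-factor u zero g eq a = lookup-prefix u g eq a
lookup-factor {n = suc n} (x ∷ u) (suc i) g eq a with lookup-factor u i g eq a
... | r , toℕ-r , lookup-r = Fin.suc r , cong suc toℕ-r , lookup-r

wordMatrix : ∀ {n} (u : List (Fin n)) → Matrix (length u) n
wordMatrix u r c = does (c ≟ lookup u r)

universal⇒superRows : ∀ {n} L → UniversalLength (suc n) L → SuperRows (suc n) L
universal⇒superRows _ (u , refl , universal) = wordMatrix u , superpermutation
  where
  superpermutation : IsSuperpermutationMatrix _ (wordMatrix u)
  superpermutation π with universal (flip π)
  ... | k , i , factor = i₀ , k , entry
    where
    row : ∀ a → ∃[ r ] toℕ r ≡ i + toℕ a × lookup u r ≡ σ^ (toℕ k) (π ⟨$⟩ˡ a)
    row = lookup-factor u i (λ a → σ^ (toℕ k) (π ⟨$⟩ˡ a)) factor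

    i₀ : Fin (length u)
    i₀ = proj₁ (row Fin.zero)

    row-at : ∀ a → cyc i₀ (toℕ a) ≡ proj₁ (row a)
    row-at a = cyc-without-wrap i₀ _ (toℕ a) (begin
      toℕ i₀ + toℕ a  ≡⟨ cong (_+ toℕ a) (trans (proj₁ (proj₂ (row Fin.zero))) (+-identityʳ i)) ⟩
      i + toℕ a       ≡⟨ sym (proj₁ (proj₂ (row a))) ⟩
      toℕ (proj₁ (row a)) ∎)

    entry : ∀ a b → wordMatrix u (cyc i₀ (toℕ a)) (cyc k (toℕ b)) ≡ permMatrix π a b
    entry a b = begin
      does (cyc k (toℕ b) ≟ lookup u (cyc i₀ (toℕ a)))
        ≡⟨ cong (λ r → does (cyc k (toℕ b) ≟ lookup u r)) (row-at a) ⟩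
      does (cyc k (toℕ b) ≟ lookup u (proj₁ (row a)))
        ≡⟨ cong (λ x → does (cyc k (toℕ b) ≟ x)) (proj₂ (proj₂ (row a))) ⟩
      does (cyc k (toℕ b) ≟ σ^ (toℕ k) (π ⟨$⟩ˡ a))
        ≡⟨ does-⇔ (cyc-≡-σ^-⇔ k b (π ⟨$⟩ˡ a)) (cyc k (toℕ b) ≟ σ^ (toℕ k) (π ⟨$⟩ˡ a)) (b ≟ π ⟨$⟩ˡ a) ⟩
      does (b ≟ π ⟨$⟩ˡ a)
        ≡⟨ permMatrix-flip π a b ⟩
      does (a ≟ π ⟨$⟩ʳ b) ∎

does≡true⇒ : ∀ {P : Set} (p : Dec P) → does p ≡ true → P
does≡true⇒ p eq = invert (subst (Reflects _) eq (proof p))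

choose : ∀ {n} {P : Fin (suc n) → Set} → Dec (∃[ c ] P c) → Fin (suc n)
choose (yes (c , _)) = c
choose (no _)        = Fin.zero

choose-unique : ∀ {n} {P : Fin (suc n) → Set} (d : Dec (∃[ c ] P c)) c →
  P c → (∀ c′ → P c′ → c′ ≡ c) → choose d ≡ c
choose-unique (yes (c′ , p)) c _  unique = unique c′ p
choose-unique (no ¬p)        c pc _      = ⊥-elim (¬p (c , pc))

-- Rows that meet no block may hold no 1 or several; they get an arbitrary column.
rowColumn : ∀ {m n} → Matrix m (suc n) → Fin m → Fin (suc n)
rowColumn T r = choose (any? (λ c → T r c ≟ᵇ true))

rowColumn-block : ∀ {m n} (T : Matrix m (suc n)) (ρ : Permutation′ (suc n)) i₀ j₀ →
  (∀ a b → T (cyc i₀ (toℕ a)) (cyc j₀ (toℕ b)) ≡ permMatrix ρ a b) →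
  ∀ a → rowColumn T (cyc i₀ (toℕ a)) ≡ cyc j₀ (toℕ (ρ ⟨$⟩ˡ a))
rowColumn-block T ρ i₀ j₀ block a = choose-unique (any? (λ c → T (cyc i₀ (toℕ a)) c ≟ᵇ true)) _ one-at unique
  where
  one-at : T (cyc i₀ (toℕ a)) (cyc j₀ (toℕ (ρ ⟨$⟩ˡ a))) ≡ true
  one-at = trans (block a _) (dec-true (a ≟ ρ ⟨$⟩ʳ (ρ ⟨$⟩ˡ a)) (sym (inverseʳ ρ)))

  unique : ∀ c → T (cyc i₀ (toℕ a)) c ≡ true → c ≡ cyc j₀ (toℕ (ρ ⟨$⟩ˡ a))
  unique c one with cyc-surjective j₀ c
  ... | b , refl = cong (cyc j₀ ∘ toℕ) (Equivalence.from (from-≡-⇔ ρ a b) a≡ρb)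
    where
    a≡ρb : a ≡ ρ ⟨$⟩ʳ b
    a≡ρb = does≡true⇒ (a ≟ ρ ⟨$⟩ʳ b) (trans (sym (block a b)) one)

take-applyUpTo : ∀ {A : Set} (f : ℕ → A) {n L} → n ≤ L → take n (applyUpTo f L) ≡ applyUpTo f n
take-applyUpTo f z≤n       = refl
take-applyUpTo f (s≤s n≤L) = cong (f 0 ∷_) (take-applyUpTo (f ∘ suc) n≤L)

take-drop-applyUpTo : ∀ {A : Set} (f : ℕ → A) i {n L} → i + n ≤ L →
  take n (drop i (applyUpTo f L)) ≡ applyUpTo (λ t → f (i + t)) n
take-drop-applyUpTo f zero    fits      = take-applyUpTo f fits
take-drop-applyUpTo f (suc i) (s≤s fits) = take-drop-applyUpTo (f ∘ suc) i fits

applyUpTo-tabulate : ∀ {A : Set} (f : ℕ → A) n → applyUpTo f n ≡ tabulate (f ∘ toℕ {n})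
applyUpTo-tabulate f zero    = refl
applyUpTo-tabulate f (suc n) = cong (f 0 ∷_) (applyUpTo-tabulate (f ∘ suc) n)

superRows⇒universal : ∀ {n M} → SuperRows (suc n) (suc M) → UniversalLength (suc n) (suc M + n)
superRows⇒universal {n} {M} (T , S) = word , length-applyUpTo letter (suc M + n) , universal
  where
  letter : ℕ → Fin (suc n)
  letter t = rowColumn T (t mod suc M)

  word : List (Fin (suc n))
  word = applyUpTo letter (suc M + n)

  universal : IsUniversalR₂ (suc n) word
  universal π with S (flip π)
  ... | i₀ , j₀ , block = j₀ , toℕ i₀ , (begin
    take (suc n) (drop (toℕ i₀) word)
      ≡⟨ take-drop-applyUpTo letter (toℕ i₀) fits ⟩
    applyUpTo (λ t → letter (toℕ i₀ + t)) (suc n)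
      ≡⟨ applyUpTo-tabulate (λ t → letter (toℕ i₀ + t)) (suc n) ⟩
    tabulate (λ a → rowColumn T (cyc i₀ (toℕ a)))
      ≡⟨ tabulate-cong (λ a → rowColumn-block T (flip π) i₀ j₀ block a) ⟩
    tabulate (λ a → cyc j₀ (toℕ (π ⟨$⟩ʳ a)))
      ≡⟨ tabulate-cong (λ a → trans (cyc-comm j₀ (π ⟨$⟩ʳ a)) (sym (σ^-cyc (toℕ j₀) (π ⟨$⟩ʳ a)))) ⟩
    oneLine (λ a → σ^ (toℕ j₀) (π ⟨$⟩ʳ a)) ∎)
    where
    fits : toℕ i₀ + suc n ≤ suc M + n
    fits = ≤-trans (≤-reflexive (+-suc (toℕ i₀) n)) (s≤s (+-monoˡ-≤ n (s≤s⁻¹ (toℕ<n i₀))))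

proposition5 : ∀ (n : ℕ) → 1 ≤ n → ∀ (m m₁ m₂ : ℕ) →
    IsLeast (UniversalLength n) m → IsLeast (SuperRows n) m₁ → IsLeast (SuperCols n) m₂ →
    (m ∸ (n ∸ 1) ≤ m₁) × (m₁ ≡ m₂) × (m₁ ≤ m)
proposition5 (suc n) _ m zero m₂ _ (rows , _) _ = ⊥-elim (¬SuperRows-zero (suc n) rows)
proposition5 (suc n) _ m (suc M) m₂ (word , word-least) (rows , rows-least) (cols , cols-least) =
  lower-bound , rows≡cols , rows-least m (universal⇒superRows m word)
  where
  lower-bound : m ∸ n ≤ suc M
  lower-bound = m≤n+o⇒m∸n≤o m n (subst (m ≤_) (+-comm (suc M) n) (word-least _ (superRows⇒universal rows)))

  rows≡cols : suc M ≡ m₂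
  rows≡cols = ≤-antisym (rows-least m₂ (superCols⇒superRows _ m₂ cols))
                        (cols-least (suc M) (superRows⇒superCols _ (suc M) rows))
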